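{- The number of (labelled) IP-SEG graphs on the vertex set $\{1,\dots,n\}$ is at most $2^{O(n\log n)}$; in particular IP-SEG graphs (and hence IP-SEG* graphs) admit an implicit representation using $O(\log n)$ bits per vertex, from which adjacency of two vertices is determined by their labels alone.
   Context: Let $L_1$ and $L_2$ be the horizontal lines $y=1$ and $y=2$. An interval segment is a segment with both endpoints on the same $L_i$; a permutation segment has one endpoint on $L_1$ and the other on $L_2$. An IP-SEG model of a graph $G$ assigns to each vertex an interval or permutation segment so that two distinct vertices are adjacent iff their segments intersect; $G$ is an IP-SEG graph if it has such a model, and an IP-SEG* graph if it has such a model in which all interval segments lie on the same line $L_i$.
   Formalization: The interval and permutation segments of every IP-SEG model have rational endpoint x-coordinates on the lines $L_1$ and $L_2$. -}

module Defs where

open import Data.Bool using (Bool; true; false)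
open import Data.Nat as ℕ using (ℕ; suc; _^_)
open import Data.Nat.Logarithm using (⌈log₂_⌉)
open import Data.Fin using (Fin)
open import Data.List using (List; length)
open import Data.Product using (Σ; ∃; ∃-syntax; _×_; _,_)
open import Data.Rational using (ℚ; _≤_; _<_; _+_; _-_; _*_; 0ℚ; 1ℚ)
open import Relation.Binary.PropositionalEquality using (_≡_; _≢_)
open import Relation.Nullary using (¬_)

data Line : Set where
  L₁ L₂ : Line

height : Line → ℚ
height L₁ = 1ℚ
height L₂ = 1ℚ + 1ℚ

data Seg : Set where
  interval : (i : Line) (a b : ℚ) → a < b → Seg
  -- permutation segment from (p , 1) on L₁ to (q , 2) on L₂
  perm     : (p q : ℚ) → Seg

OnSeg : Seg → ℚ → ℚ → Set
OnSeg (interval i a b _) x y = (y ≡ height i) × (a ≤ x) × (x ≤ b)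
OnSeg (perm p q) x y =
  ∃[ t ] ((0ℚ ≤ t) × (t ≤ 1ℚ) × (x ≡ p + t * (q - p)) × (y ≡ 1ℚ + t))

Intersect : Seg → Seg → Set
Intersect s s' = ∃[ x ] ∃[ y ] (OnSeg s x y × OnSeg s' x y)

record Graph (n : ℕ) : Set where
  field
    adj   : Fin n → Fin n → Bool
    sym   : ∀ u v → adj u v ≡ adj v u
    irrfl : ∀ v → adj v v ≡ false
open Graph public

IsIPSEGModel : ∀ {n} → Graph n → (Fin n → Seg) → Set
IsIPSEGModel {n} G m =
  ∀ (u v : Fin n) → u ≢ v →
    ((adj G u v ≡ true → Intersect (m u) (m v)) ×
     (Intersect (m u) (m v) → adj G u v ≡ true))

IsIPSEG : ∀ {n} → Graph n → Set
IsIPSEG {n} G = ∃[ m ] IsIPSEGModel G m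

-- "There are at most K labelled IP-SEG graphs on Fin n": some K adjacency
-- matrices cover (up to equality of adjacency) every IP-SEG graph on Fin n.
AtMostIPSEG : ℕ → ℕ → Set
AtMostIPSEG n K =
  Σ (Fin K → Fin n → Fin n → Bool) λ f →
    (G : Graph n) → IsIPSEG G →
      ∃[ i ] (∀ (u v : Fin n) → f i u v ≡ adj G u v)

-- Implicit representation with labels of length ≤ c·(1 + ⌈log₂ n⌉) and a
-- single decoder D used for all n and all graphs of the class.
ImplicitRepIPSEG : Set
ImplicitRepIPSEG =
  ∃[ c ] Σ (List Bool → List Bool → Bool) λ D →
    ∀ (n : ℕ) (G : Graph n) → IsIPSEG G →
      Σ (Fin n → List Bool) λ ℓ →
        (∀ v → length (ℓ v) ℕ.≤ c ℕ.* (1 ℕ.+ ⌈log₂ n ⌉)) ×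
        (∀ u v → u ≢ v → adj G u v ≡ D (ℓ u) (ℓ v))

module Submission where

-- Whether two segments intersect depends only on their kinds (interval on
-- L₁, interval on L₂, permutation segment) and on the relative order of their
-- endpoint abscissae: SegmentPatterns.meetRule states the rule for an
-- arbitrary comparison, Geometry proves that it describes intersection.
-- Replacing every abscissa by its rank among the 2n endpoint abscissae of a
-- model preserves and reflects this order (Ranks), so each vertex gets a
-- label (kind, rank, rank) with ranks below 2n, and adjacency is a fixed
-- function of the two labels (Labels.adj-by-labels).  Coding labels in
-- Fin (3 · (2n)²) bounds the number of IP-SEG graphs on n vertices by
-- (3 · (2n)²) ^ n ≤ 2 ^ (4 · n · (1 + ⌈log₂ n⌉)) (Counting, Bounds); writing
-- the kind in two bits and each rank in 1 + ⌈log₂ n⌉ bits gives labels of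
-- length at most 4 · (1 + ⌈log₂ n⌉), decodable without knowing n (BinaryLabels).

module SegmentPatterns where

  open import Defs hiding (sym)
  open import Data.Bool using (Bool; true; false; _∧_; _∨_)
  open import Data.Rational using (ℚ)
  open import Relation.Binary.PropositionalEquality using (_≡_; cong; cong₂)

  data Kind : Set where
    interval    : Line → Kind
    permutation : Kind

  kind : Seg → Kind
  kind (interval i _ _ _) = interval i
  kind (perm _ _)         = permutation

  end₁ end₂ : Seg → ℚ
  end₁ (interval _ a _ _) = a
  end₁ (perm p _)         = p
  end₂ (interval _ _ b _) = b
  end₂ (perm _ q)         = q

  sameLine : Line → Line → Bool
  sameLine L₁ L₁ = true
  sameLine L₂ L₂ = true
  sameLine _  _  = false

  -- The endpoint of a permutation segment with abscissae (p , q) lying on line i.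
  pick : {X : Set} → Line → X → X → X
  pick L₁ p _ = p
  pick L₂ _ q = q

  meetRule : {X : Set} → (X → X → Bool) → Kind → X → X → Kind → X → X → Bool
  meetRule le (interval i) a b (interval j) a' b' = sameLine i j ∧ (le a b' ∧ le a' b)
  meetRule le (interval i) a b permutation  p q   = le a (pick i p q) ∧ le (pick i p q) b
  meetRule le permutation  p q (interval i) a b   = le a (pick i p q) ∧ le (pick i p q) b
  meetRule le permutation  p q permutation  p' q' = (le p p' ∧ le q' q) ∨ (le p' p ∧ le q q')

  -- meetRule only looks at comparisons, so any map f that transports the
  -- comparison le to le' on the relevant values (those satisfying P)
  -- transports the rule.
  meetRule-transport : ∀ {X Y : Set} (le : X → X → Bool) (le' : Y → Y → Bool) (f : X → Y) (P : X → Set) →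
    (∀ {x y} → P x → P y → le x y ≡ le' (f x) (f y)) →
    ∀ k {x₁ x₂} k' {y₁ y₂} → P x₁ → P x₂ → P y₁ → P y₂ →
    meetRule le k x₁ x₂ k' y₁ y₂ ≡ meetRule le' k (f x₁) (f x₂) k' (f y₁) (f y₂)
  meetRule-transport le le' f P H (interval i) (interval j) p₁ p₂ q₁ q₂ =
    cong (sameLine i j ∧_) (cong₂ _∧_ (H p₁ q₂) (H q₁ p₂))
  meetRule-transport le le' f P H (interval L₁) permutation p₁ p₂ q₁ q₂ = cong₂ _∧_ (H p₁ q₁) (H q₁ p₂)
  meetRule-transport le le' f P H (interval L₂) permutation p₁ p₂ q₁ q₂ = cong₂ _∧_ (H p₁ q₂) (H q₂ p₂)
  meetRule-transport le le' f P H permutation (interval L₁) p₁ p₂ q₁ q₂ = cong₂ _∧_ (H q₁ p₁) (H p₁ q₂)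
  meetRule-transport le le' f P H permutation (interval L₂) p₁ p₂ q₁ q₂ = cong₂ _∧_ (H q₁ p₂) (H p₂ q₂)
  meetRule-transport le le' f P H permutation permutation p₁ p₂ q₁ q₂ =
    cong₂ _∨_ (cong₂ _∧_ (H p₁ q₁) (H q₂ p₂)) (cong₂ _∧_ (H q₁ p₁) (H p₂ q₂))


module Geometry where

  open import Defs hiding (sym)
  open SegmentPatterns
  open import Data.Bool using (Bool; T; _∧_)
  open import Data.Bool.Properties using (T-∧; T-∨)
  open import Data.Empty using (⊥-elim)
  open import Data.Product using (∃-syntax; _×_; _,_)
  open import Data.Product.Function.NonDependent.Propositional using (_×-⇔_)
  open import Data.Rational
    using (ℚ; _≤_; _<_; _+_; _-_; -_; _*_; 0ℚ; 1ℚ; _≤ᵇ_; 1/_; NonZero; NonNegative; positive; nonNegative)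
  open import Data.Rational.Properties
  open import Algebra.Properties.Group +-0-group using (∙-cancelˡ)
  open import Data.Rational.Solver using (module +-*-Solver)
  open import Data.Sum using (_⊎_; inj₁; inj₂)
  open import Data.Sum.Function.Propositional using (_⊎-⇔_)
  open import Function.Bundles using (_⇔_; mk⇔; Equivalence)
  open import Function.Properties.Equivalence using () renaming (trans to ⇔-trans; sym to ⇔-sym)
  open import Relation.Binary.Definitions using (tri<; tri≈; tri>)
  open import Relation.Binary.PropositionalEquality
  open import Relation.Nullary using (yes; no)
  open +-*-Solver

  Intersect-comm : ∀ s s' → Intersect s s' ⇔ Intersect s' s
  Intersect-comm s s' = mk⇔ swap swap
    where
    swap : ∀ {s s'} → Intersect s s' → Intersect s' s
    swap (x , y , on , on') = x , y , on' , on

  lerp : ℚ → ℚ → ℚ → ℚ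
  lerp p q t = p + t * (q - p)

  -- The parameter t at which a permutation segment reaches line i.
  level : Line → ℚ
  level L₁ = 0ℚ
  level L₂ = 1ℚ

  0≤level : ∀ i → 0ℚ ≤ level i
  0≤level L₁ = ≤-refl
  0≤level L₂ = ≤ᵇ⇒≤ _

  level≤1 : ∀ i → level i ≤ 1ℚ
  level≤1 L₁ = ≤ᵇ⇒≤ _
  level≤1 L₂ = ≤-refl

  height-level : ∀ i → height i ≡ 1ℚ + level i
  height-level L₁ = refl
  height-level L₂ = refl

  lerp-level : ∀ i p q → lerp p q (level i) ≡ pick i p q
  lerp-level L₁ = solve 2 (λ p q → p :+ con 0ℚ :* (q :- p) := p) refl
  lerp-level L₂ = solve 2 (λ p q → p :+ con 1ℚ :* (q :- p) := q) refl

  height-injective : ∀ {i j} → height i ≡ height j → i ≡ j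
  height-injective {L₁} {L₁} _ = refl
  height-injective {L₂} {L₂} _ = refl
  height-injective {L₁} {L₂} ()
  height-injective {L₂} {L₁} ()

  perm-on-line : ∀ i p q {x} → OnSeg (perm p q) x (height i) → x ≡ pick i p q
  perm-on-line i p q {x} (t , _ , _ , x≡ , y≡) = begin
    x                  ≡⟨ x≡ ⟩
    lerp p q t         ≡⟨ cong (lerp p q) t≡level ⟩
    lerp p q (level i) ≡⟨ lerp-level i p q ⟩
    pick i p q         ∎
    where
    open ≡-Reasoning
    t≡level : t ≡ level i
    t≡level = ∙-cancelˡ 1ℚ t (level i) (trans (sym y≡) (height-level i))

  pick-on-perm : ∀ i p q → OnSeg (perm p q) (pick i p q) (height i)
  pick-on-perm i p q = level i , 0≤level i , level≤1 i , sym (lerp-level i p q) , height-level i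

  interval-interval : ∀ i j a b a' b' (a<b : a < b) (a'<b' : a' < b') →
    Intersect (interval i a b a<b) (interval j a' b' a'<b') ⇔ (i ≡ j × a ≤ b' × a' ≤ b)
  interval-interval i j a b a' b' a<b a'<b' = mk⇔ to from
    where
    to : Intersect (interval i a b a<b) (interval j a' b' a'<b') → i ≡ j × a ≤ b' × a' ≤ b
    to (x , y , (y≡i , a≤x , x≤b) , (y≡j , a'≤x , x≤b')) =
      height-injective (trans (sym y≡i) y≡j) , ≤-trans a≤x x≤b' , ≤-trans a'≤x x≤b
    from : i ≡ j × a ≤ b' × a' ≤ b → Intersect (interval i a b a<b) (interval j a' b' a'<b')
    from (refl , a≤b' , a'≤b) with ≤-total a a'
    ... | inj₁ a≤a' = a' , height i , (refl , a≤a' , a'≤b) , (refl , ≤-refl , <⇒≤ a'<b')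
    ... | inj₂ a'≤a = a , height i , (refl , ≤-refl , <⇒≤ a<b) , (refl , a'≤a , a≤b')

  interval-perm : ∀ i a b (a<b : a < b) p q →
    Intersect (interval i a b a<b) (perm p q) ⇔ (a ≤ pick i p q × pick i p q ≤ b)
  interval-perm i a b a<b p q = mk⇔ to from
    where
    to : Intersect (interval i a b a<b) (perm p q) → a ≤ pick i p q × pick i p q ≤ b
    to (x , _ , (refl , a≤x , x≤b) , onPerm) with refl ← perm-on-line i p q onPerm = a≤x , x≤b
    from : a ≤ pick i p q × pick i p q ≤ b → Intersect (interval i a b a<b) (perm p q)
    from (a≤x , x≤b) = pick i p q , height i , (refl , a≤x , x≤b) , pick-on-perm i p q

  0≤difference : ∀ {x y} → x ≤ y → 0ℚ ≤ y - x
  0≤difference {x} {y} x≤y = subst (_≤ y - x) (+-inverseʳ x) (+-monoˡ-≤ (- x) x≤y)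

  p≤p+q : ∀ {p q} → 0ℚ ≤ q → p ≤ p + q
  p≤p+q {p} {q} 0≤q = subst (_≤ p + q) (+-identityʳ p) (+-monoʳ-≤ p 0≤q)

  lerp-convex : ∀ p q t → lerp p q t ≡ (1ℚ - t) * p + t * q
  lerp-convex = solve 3 (λ p q t → p :+ t :* (q :- p) := (con 1ℚ :- t) :* p :+ t :* q) refl

  lerp-< : ∀ {p q p' q' t} → p < p' → q < q' → 0ℚ ≤ t → t ≤ 1ℚ → lerp p q t < lerp p' q' t
  lerp-< {p} {q} {p'} {q'} {t} p<p' q<q' 0≤t t≤1 with <-cmp 0ℚ t
  ... | tri≈ _ refl _ = subst₂ _<_ (sym (lerp-level L₁ p q)) (sym (lerp-level L₁ p' q')) p<p'
  ... | tri> _ _ t<0  = ⊥-elim (<-irrefl refl (≤-<-trans 0≤t t<0))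
  ... | tri< 0<t _ _  = subst₂ _<_ (sym (lerp-convex p q t)) (sym (lerp-convex p' q' t)) (+-mono-≤-< weight₀ weight₁)
    where
    weight₀ : (1ℚ - t) * p ≤ (1ℚ - t) * p'
    weight₀ = *-monoˡ-≤-nonNeg (1ℚ - t) {{nonNegative (0≤difference t≤1)}} (<⇒≤ p<p')
    weight₁ : t * q < t * q'
    weight₁ = *-monoʳ-<-pos t {{positive 0<t}} q<q'

  crossing-order : ∀ {p q p' q' t} → 0ℚ ≤ t → t ≤ 1ℚ → lerp p q t ≡ lerp p' q' t →
    (p ≤ p' × q' ≤ q) ⊎ (p' ≤ p × q ≤ q')
  crossing-order {p} {q} {p'} {q'} 0≤t t≤1 e with p ≤? p' | q' ≤? q
  ... | yes p≤p' | yes q'≤q = inj₁ (p≤p' , q'≤q)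
  ... | _        | no q'≰q  =
    inj₂ (≮⇒≥ (λ p<p' → <-irrefl e (lerp-< p<p' (≰⇒> q'≰q) 0≤t t≤1)) , <⇒≤ (≰⇒> q'≰q))
  ... | no p≰p'  | yes _    =
    inj₂ (<⇒≤ (≰⇒> p≰p') , ≮⇒≥ (λ q'<q → <-irrefl (sym e) (lerp-< (≰⇒> p≰p') q'<q 0≤t t≤1)))

  ratio : ∀ {d₁ d₂} → 0ℚ ≤ d₁ → 0ℚ ≤ d₂ → ∃[ t ] (0ℚ ≤ t × t ≤ 1ℚ × t * (d₁ + d₂) ≡ d₁)
  ratio {d₁} {d₂} 0≤d₁ 0≤d₂ with 0ℚ <? d₁ + d₂
  ... | yes 0<d = t , 0≤t , t≤1 , t*d≡d₁
    where
    d : ℚ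
    d = d₁ + d₂
    instance
      d≢0 : NonZero d
      d≢0 = pos⇒nonZero d {{positive 0<d}}
      1/d≥0 : NonNegative (1/ d)
      1/d≥0 = pos⇒nonNeg (1/ d) {{1/pos⇒pos d {{positive 0<d}}}}
    t : ℚ
    t = d₁ * 1/ d
    0≤t : 0ℚ ≤ t
    0≤t = subst (_≤ t) (*-zeroˡ (1/ d)) (*-monoʳ-≤-nonNeg (1/ d) 0≤d₁)
    t≤1 : t ≤ 1ℚ
    t≤1 = subst (t ≤_) (*-inverseʳ d) (*-monoʳ-≤-nonNeg (1/ d) (p≤p+q {d₁} 0≤d₂))
    t*d≡d₁ : t * d ≡ d₁
    t*d≡d₁ = trans (*-assoc d₁ (1/ d) d) (trans (cong (d₁ *_) (*-inverseˡ d)) (*-identityʳ d₁))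
  ... | no 0≮d = 0ℚ , ≤-refl , ≤ᵇ⇒≤ _ , trans (*-zeroˡ (d₁ + d₂)) (sym d₁≡0)
    where
    d₁≡0 : d₁ ≡ 0ℚ
    d₁≡0 = ≤-antisym (≤-trans (p≤p+q {d₁} 0≤d₂) (≮⇒≥ 0≮d)) 0≤d₁

  lerp-gap : ∀ p q p' q' t → lerp p q t ≡ lerp p' q' t + (t * ((p' - p) + (q - q')) - (p' - p))
  lerp-gap = solve 5 (λ p q p' q' t →
    p :+ t :* (q :- p) := (p' :+ t :* (q' :- p')) :+ (t :* ((p' :- p) :+ (q :- q')) :- (p' :- p))) refl

  crossing-point : ∀ {p q p' q'} → p ≤ p' → q' ≤ q → ∃[ t ] (0ℚ ≤ t × t ≤ 1ℚ × lerp p q t ≡ lerp p' q' t)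
  crossing-point {p} {q} {p'} {q'} p≤p' q'≤q with ratio (0≤difference p≤p') (0≤difference q'≤q)
  ... | t , 0≤t , t≤1 , t*d≡d₁ = t , 0≤t , t≤1 , (begin
    lerp p q t                                                ≡⟨ lerp-gap p q p' q' t ⟩
    lerp p' q' t + (t * ((p' - p) + (q - q')) - (p' - p))     ≡⟨ cong (λ z → lerp p' q' t + (z - (p' - p))) t*d≡d₁ ⟩
    lerp p' q' t + ((p' - p) - (p' - p))                      ≡⟨ cong (lerp p' q' t +_) (+-inverseʳ (p' - p)) ⟩
    lerp p' q' t + 0ℚ                                         ≡⟨ +-identityʳ (lerp p' q' t) ⟩
    lerp p' q' t                                              ∎)
    where open ≡-Reasoning

  perm-perm : ∀ p q p' q' → Intersect (perm p q) (perm p' q') ⇔ ((p ≤ p' × q' ≤ q) ⊎ (p' ≤ p × q ≤ q'))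
  perm-perm p q p' q' = mk⇔ to from
    where
    to : Intersect (perm p q) (perm p' q') → (p ≤ p' × q' ≤ q) ⊎ (p' ≤ p × q ≤ q')
    to (x , y , (t , 0≤t , t≤1 , x≡ , y≡) , (t' , _ , _ , x≡' , y≡')) =
      crossing-order {p} {q} {p'} {q'} {t} 0≤t t≤1 (trans (sym x≡) (trans x≡' (cong (lerp p' q') (sym t≡t'))))
      where
      t≡t' : t ≡ t'
      t≡t' = ∙-cancelˡ 1ℚ t t' (trans (sym y≡) y≡')
    meet : ∀ {p q p' q'} → p ≤ p' → q' ≤ q → Intersect (perm p q) (perm p' q')
    meet {p} {q} {p'} {q'} p≤p' q'≤q = through (crossing-point p≤p' q'≤q)
      where
      through : ∃[ t ] (0ℚ ≤ t × t ≤ 1ℚ × lerp p q t ≡ lerp p' q' t) → Intersect (perm p q) (perm p' q')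
      through (t , 0≤t , t≤1 , same) =
        lerp p q t , 1ℚ + t , (t , 0≤t , t≤1 , refl , refl) , (t , 0≤t , t≤1 , same , refl)
    from : (p ≤ p' × q' ≤ q) ⊎ (p' ≤ p × q ≤ q') → Intersect (perm p q) (perm p' q')
    from (inj₁ (p≤p' , q'≤q)) = meet p≤p' q'≤q
    from (inj₂ (p'≤p , q≤q')) = Equivalence.to (Intersect-comm (perm p' q') (perm p q)) (meet p'≤p q≤q')

  ≤ᵇ⇔≤ : ∀ x y → T (x ≤ᵇ y) ⇔ x ≤ y
  ≤ᵇ⇔≤ x y = mk⇔ ≤ᵇ⇒≤ ≤⇒≤ᵇ

  ≤ᵇ-pair⇔ : ∀ a b c d → T ((a ≤ᵇ b) ∧ (c ≤ᵇ d)) ⇔ (a ≤ b × c ≤ d)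
  ≤ᵇ-pair⇔ a b c d = ⇔-trans (T-∧ {a ≤ᵇ b} {c ≤ᵇ d}) (≤ᵇ⇔≤ a b ×-⇔ ≤ᵇ⇔≤ c d)

  sameLine⇔ : ∀ {i j} → T (sameLine i j) ⇔ i ≡ j
  sameLine⇔ {L₁} {L₁} = mk⇔ (λ _ → refl) (λ _ → _)
  sameLine⇔ {L₂} {L₂} = mk⇔ (λ _ → refl) (λ _ → _)
  sameLine⇔ {L₁} {L₂} = mk⇔ (λ ()) (λ ())
  sameLine⇔ {L₂} {L₁} = mk⇔ (λ ()) (λ ())

  Meets : Seg → Seg → Bool
  Meets s s' = meetRule _≤ᵇ_ (kind s) (end₁ s) (end₂ s) (kind s') (end₁ s') (end₂ s')

  intersect⇔meets : ∀ s s' → Intersect s s' ⇔ T (Meets s s')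
  intersect⇔meets (interval i a b a<b) (interval j a' b' a'<b') =
    ⇔-trans (interval-interval i j a b a' b' a<b a'<b')
            (⇔-sym (⇔-trans (T-∧ {sameLine i j}) (sameLine⇔ ×-⇔ ≤ᵇ-pair⇔ a b' a' b)))
  intersect⇔meets (interval i a b a<b) (perm p q) =
    ⇔-trans (interval-perm i a b a<b p q) (⇔-sym (≤ᵇ-pair⇔ a (pick i p q) (pick i p q) b))
  intersect⇔meets (perm p q) (interval i a b a<b) =
    ⇔-trans (Intersect-comm (perm p q) (interval i a b a<b))
            (⇔-trans (interval-perm i a b a<b p q) (⇔-sym (≤ᵇ-pair⇔ a (pick i p q) (pick i p q) b)))
  intersect⇔meets (perm p q) (perm p' q') =
    ⇔-trans (perm-perm p q p' q')
            (⇔-sym (⇔-trans (T-∨ {(p ≤ᵇ p') ∧ (q' ≤ᵇ q)}) (≤ᵇ-pair⇔ p p' q' q ⊎-⇔ ≤ᵇ-pair⇔ p' p q q')))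


module Ranks where

  open Geometry using (≤ᵇ⇔≤)
  open import Data.Bool using (Bool; true; false; T; if_then_else_)
  open import Data.Empty using (⊥-elim)
  open import Data.List using (List; []; _∷_; length)
  open import Data.List.Membership.Propositional using (_∈_)
  open import Data.List.Relation.Unary.Any using (here; there)
  open import Data.Nat as ℕ using (ℕ; suc; z≤n; s≤s)
  import Data.Nat.Properties as ℕ
  open import Data.Rational using (ℚ; _≤_; _<_; _≤ᵇ_)
  open import Data.Rational.Properties using (_<?_; <-≤-trans; <-trans; <-irrefl; ≮⇒≥)
  open import Function using (_∘_)
  open import Function.Bundles using (_⇔_; mk⇔; Equivalence)
  open import Function.Properties.Equivalence using () renaming (trans to ⇔-trans)
  open import Relation.Binary.PropositionalEquality
  open import Relation.Nullary using (¬_)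
  open import Relation.Nullary.Decidable using (isYes; toWitness; fromWitness)

  T-injective : ∀ {a b} → (T a ⇔ T b) → a ≡ b
  T-injective {true}  {true}  _ = refl
  T-injective {true}  {false} e = ⊥-elim (Equivalence.to e _)
  T-injective {false} {true}  e = ⊥-elim (Equivalence.from e _)
  T-injective {false} {false} _ = refl

  count : {A : Set} → (A → Bool) → List A → ℕ
  count P []       = 0
  count P (x ∷ xs) = if P x then suc (count P xs) else count P xs

  count-mono : ∀ {A : Set} (P Q : A → Bool) → (∀ z → T (P z) → T (Q z)) →
    ∀ xs → count P xs ℕ.≤ count Q xs
  count-mono P Q P⇒Q []       = z≤n
  count-mono P Q P⇒Q (x ∷ xs) with P x | Q x | P⇒Q x
  ... | true  | true  | _   = s≤s (count-mono P Q P⇒Q xs)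
  ... | true  | false | imp = ⊥-elim (imp _)
  ... | false | true  | _   = ℕ.m≤n⇒m≤1+n (count-mono P Q P⇒Q xs)
  ... | false | false | _   = count-mono P Q P⇒Q xs

  count-strict : ∀ {A : Set} (P Q : A → Bool) → (∀ z → T (P z) → T (Q z)) →
    ∀ {w} xs → w ∈ xs → ¬ T (P w) → T (Q w) → count P xs ℕ.< count Q xs
  count-strict P Q P⇒Q (x ∷ xs) (here refl) ¬Px Qx with P x | Q x | ¬Px | Qx
  ... | true  | _     | ¬tt | _  = ⊥-elim (¬tt _)
  ... | false | true  | _   | _  = s≤s (count-mono P Q P⇒Q xs)
  ... | false | false | _   | ()
  count-strict P Q P⇒Q (x ∷ xs) (there w∈xs) ¬Pw Qw with P x | Q x | P⇒Q x
  ... | true  | true  | _   = s≤s (count-strict P Q P⇒Q xs w∈xs ¬Pw Qw)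
  ... | true  | false | imp = ⊥-elim (imp _)
  ... | false | true  | _   = ℕ.m≤n⇒m≤1+n (count-strict P Q P⇒Q xs w∈xs ¬Pw Qw)
  ... | false | false | _   = count-strict P Q P⇒Q xs w∈xs ¬Pw Qw

  count-all : ∀ {A : Set} (xs : List A) → count (λ _ → true) xs ≡ length xs
  count-all []       = refl
  count-all (x ∷ xs) = cong suc (count-all xs)

  below : ℚ → ℚ → Bool
  below x z = isYes (z <? x)

  below-intro : ∀ {x z} → z < x → T (below x z)
  below-intro {x} {z} = fromWitness {a? = z <? x}

  below-elim : ∀ {x z} → T (below x z) → z < x
  below-elim {x} {z} = toWitness {a? = z <? x}

  rank : List ℚ → ℚ → ℕ
  rank L x = count (below x) L

  rank-mono : ∀ L {x y} → x ≤ y → rank L x ℕ.≤ rank L y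
  rank-mono L x≤y = count-mono _ _ (λ z z<x → below-intro (<-≤-trans (below-elim z<x) x≤y)) L

  rank-strict : ∀ L {x y} → y ∈ L → y < x → rank L y ℕ.< rank L x
  rank-strict L {x} {y} y∈L y<x =
    count-strict _ _ (λ z z<y → below-intro (<-trans (below-elim z<y) y<x)) L y∈L
      (<-irrefl refl ∘ below-elim) (below-intro y<x)

  -- An entry of L is not below itself, so its rank is less than the length of L.
  rank-bound : ∀ L {x} → x ∈ L → rank L x ℕ.< length L
  rank-bound L {x} x∈L = subst (rank L x ℕ.<_) (count-all L)
    (count-strict (below x) (λ _ → true) (λ _ _ → _) L x∈L (<-irrefl refl ∘ below-elim) _)

  rank-≤⇔ : ∀ L {x y} → y ∈ L → x ≤ y ⇔ rank L x ℕ.≤ rank L y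
  rank-≤⇔ L y∈L = mk⇔ (rank-mono L) (λ rx≤ry → ≮⇒≥ (λ y<x → ℕ.<⇒≱ (rank-strict L y∈L y<x) rx≤ry))

  rank-≤ᵇ : ∀ L {x y} → y ∈ L → (x ≤ᵇ y) ≡ (rank L x ℕ.≤ᵇ rank L y)
  rank-≤ᵇ L {x} {y} y∈L = T-injective
    (⇔-trans (≤ᵇ⇔≤ x y) (⇔-trans (rank-≤⇔ L y∈L) (mk⇔ ℕ.≤⇒≤ᵇ (ℕ.≤ᵇ⇒≤ (rank L x) (rank L y)))))


module Labels where

  open import Defs hiding (sym)
  open SegmentPatterns
  open Geometry using (Meets; intersect⇔meets)
  open Ranks
  open import Data.Bool using (Bool)
  open import Data.Bool.Properties using (T-≡)
  open import Data.Fin using (Fin; zero; suc)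
  open import Data.List using (List; []; _∷_; length)
  open import Data.List.Membership.Propositional using (_∈_)
  open import Data.List.Relation.Unary.Any using (here; there)
  open import Data.Nat as ℕ using (ℕ; zero; suc)
  import Data.Nat.Properties as ℕ
  open import Data.Product using (_×_; _,_; proj₁; proj₂)
  open import Data.Rational using (ℚ; _≤ᵇ_)
  open import Function using (_∘_)
  open import Function.Bundles using (mk⇔)
  open import Function.Properties.Equivalence using () renaming (trans to ⇔-trans)
  open import Relation.Binary.PropositionalEquality

  endpoints : ∀ {n} → (Fin n → Seg) → List ℚ
  endpoints {zero}  m = []
  endpoints {suc n} m = end₁ (m zero) ∷ end₂ (m zero) ∷ endpoints (m ∘ suc)

  end₁∈endpoints : ∀ {n} (m : Fin n → Seg) v → end₁ (m v) ∈ endpoints m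
  end₁∈endpoints m zero    = here refl
  end₁∈endpoints m (suc v) = there (there (end₁∈endpoints (m ∘ suc) v))

  end₂∈endpoints : ∀ {n} (m : Fin n → Seg) v → end₂ (m v) ∈ endpoints m
  end₂∈endpoints m zero    = there (here refl)
  end₂∈endpoints m (suc v) = there (there (end₂∈endpoints (m ∘ suc) v))

  length-endpoints : ∀ {n} (m : Fin n → Seg) → length (endpoints m) ≡ n ℕ.+ n
  length-endpoints {zero}  m = refl
  length-endpoints {suc n} m = cong suc (trans (cong suc (length-endpoints (m ∘ suc))) (sym (ℕ.+-suc n n)))

  Label : Set
  Label = Kind × ℕ × ℕ

  labelAdj : Label → Label → Bool
  labelAdj (k , a , b) (k' , a' , b') = meetRule ℕ._≤ᵇ_ k a b k' a' b'

  label : ∀ {n} → (Fin n → Seg) → Fin n → Label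
  label m v = kind (m v) , rank (endpoints m) (end₁ (m v)) , rank (endpoints m) (end₂ (m v))

  Fits : ℕ → Label → Set
  Fits M (_ , a , b) = a ℕ.< M × b ℕ.< M

  label-fits : ∀ {n} (m : Fin n → Seg) v → Fits (n ℕ.+ n) (label m v)
  label-fits {n} m v = bound (end₁∈endpoints m v) , bound (end₂∈endpoints m v)
    where
    bound : ∀ {x} → x ∈ endpoints m → rank (endpoints m) x ℕ.< n ℕ.+ n
    bound x∈ = subst (rank (endpoints m) _ ℕ.<_) (length-endpoints m) (rank-bound (endpoints m) x∈)

  model-adj : ∀ {n} (G : Graph n) (m : Fin n → Seg) → IsIPSEGModel G m →
    ∀ u v → u ≢ v → adj G u v ≡ Meets (m u) (m v)
  model-adj G m model u v u≢v = T-injective (⇔-trans T-≡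
    (⇔-trans (mk⇔ (proj₁ (model u v u≢v)) (proj₂ (model u v u≢v))) (intersect⇔meets (m u) (m v))))

  adj-by-labels : ∀ {n} (G : Graph n) (m : Fin n → Seg) → IsIPSEGModel G m →
    ∀ u v → u ≢ v → adj G u v ≡ labelAdj (label m u) (label m v)
  adj-by-labels G m model u v u≢v = trans (model-adj G m model u v u≢v)
    (meetRule-transport _≤ᵇ_ ℕ._≤ᵇ_ (rank (endpoints m)) (_∈ endpoints m)
      (λ _ y∈ → rank-≤ᵇ (endpoints m) y∈)
      (kind (m u)) (kind (m v))
      (end₁∈endpoints m u) (end₂∈endpoints m u) (end₁∈endpoints m v) (end₂∈endpoints m v))


module Counting where

  open import Defs hiding (sym)
  open SegmentPatterns
  open Labels
  open import Data.Bool using (Bool; false)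
  open import Data.Empty using (⊥-elim)
  open import Data.Fin as Fin using (Fin; toℕ; fromℕ<; combine; remQuot; inject≤; finToFun; funToFin)
  import Data.Fin.Properties as Fin
  open import Data.Nat using (ℕ; _≤_; _<_; _+_; _*_; _^_)
  open import Data.Nat.Properties using (_<?_)
  open import Data.Product using (Σ; ∃-syntax; _×_; _,_; proj₁; proj₂)
  open import Relation.Binary.PropositionalEquality
  open import Relation.Nullary using (yes; no)

  kindCode : Kind → Fin 3
  kindCode (interval L₁) = Fin.zero
  kindCode (interval L₂) = Fin.suc Fin.zero
  kindCode permutation   = Fin.suc (Fin.suc Fin.zero)

  codeKind : Fin 3 → Kind
  codeKind Fin.zero                     = interval L₁
  codeKind (Fin.suc Fin.zero)           = interval L₂
  codeKind (Fin.suc (Fin.suc Fin.zero)) = permutation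

  codeKind-kindCode : ∀ k → codeKind (kindCode k) ≡ k
  codeKind-kindCode (interval L₁) = refl
  codeKind-kindCode (interval L₂) = refl
  codeKind-kindCode permutation   = refl

  encodeLabel : ∀ M (ℓ : Label) → Fits M ℓ → Fin (3 * (M * M))
  encodeLabel M (k , a , b) (a<M , b<M) = combine (kindCode k) (combine (fromℕ< a<M) (fromℕ< b<M))

  decodeRanks : ∀ M → Fin M × Fin M → ℕ × ℕ
  decodeRanks M (a , b) = toℕ a , toℕ b

  decodeKindRanks : ∀ M → Fin 3 × Fin (M * M) → Label
  decodeKindRanks M (k , ab) = codeKind k , decodeRanks M (remQuot M ab)

  decodeLabel : ∀ M → Fin (3 * (M * M)) → Label
  decodeLabel M c = decodeKindRanks M (remQuot (M * M) c)

  decode-encode : ∀ M ℓ (fits : Fits M ℓ) → decodeLabel M (encodeLabel M ℓ fits) ≡ ℓ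
  decode-encode M (k , a , b) (a<M , b<M) = begin
    decodeKindRanks M (remQuot (M * M) (combine (kindCode k) (combine a' b')))
      ≡⟨ cong (decodeKindRanks M) (Fin.remQuot-combine (kindCode k) (combine a' b')) ⟩
    codeKind (kindCode k) , decodeRanks M (remQuot M (combine a' b'))
      ≡⟨ cong₂ _,_ (codeKind-kindCode k) (cong (decodeRanks M) (Fin.remQuot-combine a' b')) ⟩
    k , toℕ a' , toℕ b'
      ≡⟨ cong₂ (λ x y → k , x , y) (Fin.toℕ-fromℕ< a<M) (Fin.toℕ-fromℕ< b<M) ⟩
    k , a , b ∎
    where
    open ≡-Reasoning
    a' b' : Fin M
    a' = fromℕ< a<M
    b' = fromℕ< b<M

  count-by-labelling : ∀ {n B} (decode : Fin B → Fin B → Bool) →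
    (∀ (G : Graph n) → IsIPSEG G →
       Σ (Fin n → Fin B) λ ℓ → ∀ u v → u ≢ v → adj G u v ≡ decode (ℓ u) (ℓ v)) →
    AtMostIPSEG n (B ^ n)
  count-by-labelling {n} {B} decode labelling = graphOf , covers
    where
    graphOf : Fin (B ^ n) → Fin n → Fin n → Bool
    graphOf i u v with u Fin.≟ v
    ... | yes _ = false
    ... | no _  = decode (finToFun i u) (finToFun i v)
    covers : ∀ G → IsIPSEG G → ∃[ i ] (∀ u v → graphOf i u v ≡ adj G u v)
    covers G isG = funToFin ℓ , agree
      where
      ℓ : Fin n → Fin B
      ℓ = proj₁ (labelling G isG)
      agree : ∀ u v → graphOf (funToFin ℓ) u v ≡ adj G u v
      agree u v with u Fin.≟ v
      ... | yes refl = sym (irrfl G u)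
      ... | no u≢v   = trans (cong₂ decode (Fin.finToFun-funToFin ℓ u) (Fin.finToFun-funToFin ℓ v))
                             (sym (proj₂ (labelling G isG) u v u≢v))

  AtMost-mono : ∀ {n K K'} → K ≤ K' → AtMostIPSEG n K → AtMostIPSEG n K'
  AtMost-mono {n} {K} {K'} K≤K' (f , covers) = f' , λ G isG →
    let (i , agree) = covers G isG in inject≤ i K≤K' , λ u v → trans (f'-inject i u v) (agree u v)
    where
    f' : Fin K' → Fin n → Fin n → Bool
    f' j with toℕ j <? K
    ... | yes j<K = f (fromℕ< j<K)
    ... | no _    = λ _ _ → false
    f'-inject : ∀ i u v → f' (inject≤ i K≤K') u v ≡ f i u v
    f'-inject i u v with toℕ (inject≤ i K≤K') <? K
    ... | yes j<K = cong (λ j → f j u v) (Fin.toℕ-injective (trans (Fin.toℕ-fromℕ< j<K) (Fin.toℕ-inject≤ i K≤K')))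
    ... | no j≮K  = ⊥-elim (j≮K (subst (_< K) (sym (Fin.toℕ-inject≤ i K≤K')) (Fin.toℕ<n i)))

  ipseg-count : ∀ n → AtMostIPSEG n ((3 * ((n + n) * (n + n))) ^ n)
  ipseg-count n = count-by-labelling (λ c c' → labelAdj (decodeLabel M c) (decodeLabel M c')) λ G (m , model) →
    (λ v → encodeLabel M (label m v) (label-fits m v)) ,
    λ u v u≢v → trans (adj-by-labels G m model u v u≢v)
      (sym (cong₂ labelAdj (decode-encode M (label m u) (label-fits m u)) (decode-encode M (label m v) (label-fits m v))))
    where
    M : ℕ
    M = n + n


module Bounds where

  open import Data.Nat using (ℕ; suc; z≤n; s≤s; _≤_; _<_; _+_; _*_; _^_; ⌈_/2⌉; ⌊_/2⌋)
  open import Data.Nat.Properties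
  open import Data.Nat.Induction using (<-wellFounded)
  open import Data.Nat.Logarithm using (⌈log₂_⌉)
  open import Data.Nat.Logarithm.Core using (⌈log2⌉)
  open import Data.Nat.Solver using (module +-*-Solver)
  open import Induction.WellFounded using (Acc; acc)
  open import Relation.Binary.PropositionalEquality
  open +-*-Solver

  n≤2^⌈log₂n⌉ : ∀ n → n ≤ 2 ^ ⌈log₂ n ⌉
  n≤2^⌈log₂n⌉ n = bound n (<-wellFounded n)
    where
    2+n≤2*[1+⌈n/2⌉] : ∀ n → 2 + n ≤ 2 * (1 + ⌈ n /2⌉)
    2+n≤2*[1+⌈n/2⌉] n = begin
      2 + n                        ≡⟨ cong (2 +_) (sym (⌊n/2⌋+⌈n/2⌉≡n n)) ⟩
      2 + (⌊ n /2⌋ + ⌈ n /2⌉)      ≤⟨ +-monoʳ-≤ 2 (+-monoˡ-≤ ⌈ n /2⌉ (⌊n/2⌋≤⌈n/2⌉ n)) ⟩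
      2 + (⌈ n /2⌉ + ⌈ n /2⌉)      ≡⟨ solve 1 (λ c → con 2 :+ (c :+ c) := con 2 :* (con 1 :+ c)) refl ⌈ n /2⌉ ⟩
      2 * (1 + ⌈ n /2⌉)            ∎
      where open ≤-Reasoning
    bound : ∀ n (rec : Acc _<_ n) → n ≤ 2 ^ ⌈log2⌉ n rec
    bound 0             _        = z≤n
    bound 1             _        = s≤s z≤n
    bound (suc (suc n)) (acc rs) = ≤-trans (2+n≤2*[1+⌈n/2⌉] n) (*-monoʳ-≤ 2 (bound (suc ⌈ n /2⌉) _))

  2n≤2^[1+⌈log₂n⌉] : ∀ n → n + n ≤ 2 ^ (1 + ⌈log₂ n ⌉)
  2n≤2^[1+⌈log₂n⌉] n = subst (n + n ≤_) (cong (2 ^ ⌈log₂ n ⌉ +_) (sym (+-identityʳ _)))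
    (+-mono-≤ (n≤2^⌈log₂n⌉ n) (n≤2^⌈log₂n⌉ n))

  -- A label with ranks below 2 ^ w takes 2 + 2w bits: two for the kind and w for each rank.
  codeLength : ℕ → ℕ
  codeLength w = 2 + (w + w)

  codeLength≤ : ∀ k → codeLength (1 + k) ≤ 4 * (1 + k)
  codeLength≤ k = subst (codeLength (1 + k) ≤_)
    (solve 1 (λ k → (con 2 :+ ((con 1 :+ k) :+ (con 1 :+ k))) :+ (k :+ k) := con 4 :* (con 1 :+ k)) refl k)
    (m≤m+n (codeLength (1 + k)) (k + k))

  labelCodes≤ : ∀ n → 3 * ((n + n) * (n + n)) ≤ 2 ^ (4 * (1 + ⌈log₂ n ⌉))
  labelCodes≤ n = begin
    3 * ((n + n) * (n + n))   ≤⟨ *-monoˡ-≤ ((n + n) * (n + n)) (n≤1+n 3) ⟩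
    4 * ((n + n) * (n + n))   ≤⟨ *-monoʳ-≤ 4 (*-mono-≤ (2n≤2^[1+⌈log₂n⌉] n) (2n≤2^[1+⌈log₂n⌉] n)) ⟩
    2 ^ 2 * (2 ^ w * 2 ^ w)   ≡⟨ cong (2 ^ 2 *_) (sym (^-distribˡ-+-* 2 w w)) ⟩
    2 ^ 2 * 2 ^ (w + w)       ≡⟨ sym (^-distribˡ-+-* 2 2 (w + w)) ⟩
    2 ^ codeLength w          ≤⟨ ^-monoʳ-≤ 2 (codeLength≤ ⌈log₂ n ⌉) ⟩
    2 ^ (4 * w)               ∎
    where
    open ≤-Reasoning
    w : ℕ
    w = 1 + ⌈log₂ n ⌉

  graphCount≤ : ∀ n → (3 * ((n + n) * (n + n))) ^ n ≤ 2 ^ (4 * (n * (1 + ⌈log₂ n ⌉)))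
  graphCount≤ n = begin
    (3 * ((n + n) * (n + n))) ^ n   ≤⟨ ^-monoˡ-≤ n (labelCodes≤ n) ⟩
    (2 ^ (4 * w)) ^ n               ≡⟨ ^-*-assoc 2 (4 * w) n ⟩
    2 ^ (4 * w * n)                 ≡⟨ cong (2 ^_) (solve 2 (λ w n → con 4 :* w :* n := con 4 :* (n :* w)) refl w n) ⟩
    2 ^ (4 * (n * w))               ∎
    where
    open ≤-Reasoning
    w : ℕ
    w = 1 + ⌈log₂ n ⌉


module BinaryLabels where

  open import Defs hiding (sym)
  open SegmentPatterns
  open Labels
  open Bounds
  open import Data.Bool using (Bool; true; false)
  open import Data.Fin using (Fin)
  open import Data.List using (List; []; _∷_; length)
  open import Data.Nat using (ℕ; zero; suc; s≤s; _≤_; _<_; _+_; _*_; _^_; ⌊_/2⌋)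
  open import Data.Nat.Properties
  open import Data.Nat.Logarithm using (⌈log₂_⌉)
  open import Data.Nat.Solver using (module +-*-Solver)
  open import Data.Product using (Σ; _×_; _,_; proj₁; proj₂)
  open import Relation.Binary.PropositionalEquality
  open +-*-Solver

  lowBit : ℕ → Bool
  lowBit 0             = false
  lowBit 1             = true
  lowBit (suc (suc x)) = lowBit x

  bitValue : Bool → ℕ
  bitValue false = 0
  bitValue true  = 1

  lowBit-half : ∀ x → bitValue (lowBit x) + 2 * ⌊ x /2⌋ ≡ x
  lowBit-half 0             = refl
  lowBit-half 1             = refl
  lowBit-half (suc (suc x)) = begin
    bitValue (lowBit x) + 2 * (1 + ⌊ x /2⌋)   ≡⟨ solve 2 (λ b h → b :+ con 2 :* (con 1 :+ h) := con 2 :+ (b :+ con 2 :* h)) refl (bitValue (lowBit x)) ⌊ x /2⌋ ⟩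
    2 + (bitValue (lowBit x) + 2 * ⌊ x /2⌋)   ≡⟨ cong (2 +_) (lowBit-half x) ⟩
    2 + x                                     ∎
    where open ≡-Reasoning

  half-< : ∀ x w → x < 2 ^ suc w → ⌊ x /2⌋ < 2 ^ w
  half-< x w x<2^[1+w] = *-cancelˡ-< 2 ⌊ x /2⌋ (2 ^ w)
    (≤-<-trans (subst (2 * ⌊ x /2⌋ ≤_) (lowBit-half x) (m≤n+m (2 * ⌊ x /2⌋) (bitValue (lowBit x)))) x<2^[1+w])

  -- The w low bits of x and y, interleaved (least significant first).
  interleave : ℕ → ℕ → ℕ → List Bool
  interleave zero    x y = []
  interleave (suc w) x y = lowBit x ∷ lowBit y ∷ interleave w ⌊ x /2⌋ ⌊ y /2⌋

  -- Reading an interleaved list back; no width is needed.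
  deinterleave : List Bool → ℕ × ℕ
  deinterleave (a ∷ b ∷ r) = bitValue a + 2 * proj₁ (deinterleave r) , bitValue b + 2 * proj₂ (deinterleave r)
  deinterleave _           = 0 , 0

  deinterleave-interleave : ∀ w x y → x < 2 ^ w → y < 2 ^ w → deinterleave (interleave w x y) ≡ (x , y)
  deinterleave-interleave zero    zero    zero    _         _         = refl
  deinterleave-interleave zero    (suc x) _       (s≤s ())  _
  deinterleave-interleave zero    zero    (suc y) _         (s≤s ())
  deinterleave-interleave (suc w) x       y       x<2^[1+w] y<2^[1+w]
    rewrite deinterleave-interleave w ⌊ x /2⌋ ⌊ y /2⌋ (half-< x w x<2^[1+w]) (half-< y w y<2^[1+w])
    = cong₂ _,_ (lowBit-half x) (lowBit-half y)

  length-interleave : ∀ w x y → length (interleave w x y) ≡ w + w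
  length-interleave zero    x y = refl
  length-interleave (suc w) x y =
    cong suc (trans (cong suc (length-interleave w ⌊ x /2⌋ ⌊ y /2⌋)) (sym (+-suc w w)))

  kindBit₁ kindBit₂ : Kind → Bool
  kindBit₁ (interval L₂) = true
  kindBit₁ _             = false
  kindBit₂ permutation   = true
  kindBit₂ _             = false

  bitsKind : Bool → Bool → Kind
  bitsKind false false = interval L₁
  bitsKind true  false = interval L₂
  bitsKind _     true  = permutation

  bitsKind-kindBits : ∀ k → bitsKind (kindBit₁ k) (kindBit₂ k) ≡ k
  bitsKind-kindBits (interval L₁) = refl
  bitsKind-kindBits (interval L₂) = refl
  bitsKind-kindBits permutation   = refl

  encodeBits : ℕ → Label → List Bool
  encodeBits w (k , a , b) = kindBit₁ k ∷ kindBit₂ k ∷ interleave w a b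

  decodeBits : List Bool → Label
  decodeBits (c₁ ∷ c₂ ∷ r) = bitsKind c₁ c₂ , deinterleave r
  decodeBits _             = permutation , 0 , 0

  decodeBits-encodeBits : ∀ w ℓ → Fits (2 ^ w) ℓ → decodeBits (encodeBits w ℓ) ≡ ℓ
  decodeBits-encodeBits w (k , a , b) (a<2^w , b<2^w) =
    cong₂ _,_ (bitsKind-kindBits k) (deinterleave-interleave w a b a<2^w b<2^w)

  length-encodeBits : ∀ w ℓ → length (encodeBits w ℓ) ≡ codeLength w
  length-encodeBits w (k , a , b) = cong (2 +_) (length-interleave w a b)

  label-fits-bits : ∀ {n} (m : Fin n → Seg) v → Fits (2 ^ (1 + ⌈log₂ n ⌉)) (label m v)
  label-fits-bits {n} m v =
    let (a<2n , b<2n) = label-fits m v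
    in <-≤-trans a<2n (2n≤2^[1+⌈log₂n⌉] n) , <-≤-trans b<2n (2n≤2^[1+⌈log₂n⌉] n)

  ipseg-implicit : ImplicitRepIPSEG
  ipseg-implicit = 4 , decodeAdj , labelling
    where
    decodeAdj : List Bool → List Bool → Bool
    decodeAdj c c' = labelAdj (decodeBits c) (decodeBits c')
    labelling : ∀ n (G : Graph n) → IsIPSEG G →
      Σ (Fin n → List Bool) λ code →
        (∀ v → length (code v) ≤ 4 * (1 + ⌈log₂ n ⌉)) × (∀ u v → u ≢ v → adj G u v ≡ decodeAdj (code u) (code v))
    labelling n G (m , model) = code , short , adj-by-codes
      where
      w : ℕ
      w = 1 + ⌈log₂ n ⌉
      code : Fin n → List Bool
      code v = encodeBits w (label m v)
      short : ∀ v → length (code v) ≤ 4 * (1 + ⌈log₂ n ⌉)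
      short v = subst (_≤ 4 * w) (sym (length-encodeBits w (label m v))) (codeLength≤ ⌈log₂ n ⌉)
      decode-code : ∀ v → decodeBits (code v) ≡ label m v
      decode-code v = decodeBits-encodeBits w (label m v) (label-fits-bits m v)
      adj-by-codes : ∀ u v → u ≢ v → adj G u v ≡ decodeAdj (code u) (code v)
      adj-by-codes u v u≢v = trans (adj-by-labels G m model u v u≢v) (sym (cong₂ labelAdj (decode-code u) (decode-code v)))


open import Defs
open import Data.Nat using (ℕ; _*_; _+_; _^_)
open import Data.Nat.Logarithm using (⌈log₂_⌉)
open import Data.Product using (_×_; ∃-syntax; _,_)
open Counting using (AtMost-mono; ipseg-count)
open Bounds using (graphCount≤)
open BinaryLabels using (ipseg-implicit)

mainTheorem2 : (∃[ c ] (∀ (n : ℕ) → AtMostIPSEG n (2 ^ (c * (n * (1 + ⌈log₂ n ⌉)))))) × ImplicitRepIPSEG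
mainTheorem2 = (4 , λ n → AtMost-mono (graphCount≤ n) (ipseg-count n)) , ipseg-implicit
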